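{- Let $2\le k<\omega$ and write $\mathbb A$ for $\mathbb A_k$. Let $\lambda<\varepsilon_0$ be a limit ordinal and $q$ a natural number. If $\zeta$ is an ordinal with $\lambda[q]<\zeta<\lambda$, then $\mathbb A(\zeta)>\mathbb A(\lambda[q])$.
   Context: Ordinals: $\varepsilon_0$ is the least ordinal $\varepsilon$ with $\omega^\varepsilon=\varepsilon$. Every $0<\xi<\varepsilon_0$ has a unique $\omega$-normal form $\xi=\omega^{\alpha}b+\gamma$ with $\alpha<\xi$, $b$ a positive natural number, $\gamma<\omega^\alpha$. $\mathrm{coeffs}(0)=\{0\}$, $\mathrm{coeffs}(\omega^\alpha b+\gamma)=\mathrm{coeffs}(\alpha)\cup\mathrm{coeffs}(\gamma)\cup\{b\}$, $\mathrm{mc}(\xi)=\max\mathrm{coeffs}(\xi)$. Fundamental sequences: $0[n]=1[n]=0$; $(\omega^\alpha b+\gamma)[n]=\omega^\alpha b+\gamma[n]$ if $\gamma>0$; $\omega^{\alpha+1}[n]=\omega^\alpha n$; $(\omega^\alpha(b+1))[n]=\omega^\alpha b+(\omega^\alpha)[n]$ if $b>0$; $(\omega^\alpha)[n]=\omega^{\alpha[n]}$ if $\alpha$ is a limit. For $2\le k<\omega$, $\mathbb A_k:\varepsilon_0\to\mathbb N$: $\mathbb A_k(\xi)=\xi+1$ if $\xi<\omega$; if $\xi\ge\omega$, write $\xi=\alpha+b$ with $\alpha$ a limit, $b<\omega$; $\mathbb A_k^{(0)}(\xi)=\mathbb A_k(\xi-1)$ if $b>0$, $=\mathrm{mc}(\xi)$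 if $b=0$; $\mathbb A_k^{(i+1)}(\xi)=\mathbb A_k(\alpha[\mathbb A_k^{(i)}(\xi)])$; $\mathbb A_k(\xi)=\mathbb A_k^{(k)}(\xi)$. -}

module Defs where

open import Data.Nat using (ℕ; zero; suc; _⊔_; _≤_; _<_)
open import Data.Bool using (Bool; true; false; if_then_else_)
open import Data.Product using (_×_; _,_; proj₁; proj₂)
open import Relation.Binary.PropositionalEquality using (_≡_; _≢_)

-- Ordinals below ε₀ in Cantor (ω-)normal form.
-- ω^ α · b + γ  denotes the ordinal ω^α·b + γ.
-- Well-formed terms (WF) are exactly the ω-normal forms: b ≥ 1 and γ < ω^α,
-- and every such term denotes an ordinal < ε₀ (and conversely).

data Cnf : Set where
  𝟎      : Cnf
  ω^_·_+_ : Cnf → ℕ → Cnf → Cnf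

data _<ₒ_ : Cnf → Cnf → Set where
  <-zero : ∀ {a b c} → 𝟎 <ₒ (ω^ a · b + c)
  <-exp  : ∀ {a b c a' b' c'} → a <ₒ a' → (ω^ a · b + c) <ₒ (ω^ a' · b' + c')
  <-coef : ∀ {a b c b' c'} → b < b' → (ω^ a · b + c) <ₒ (ω^ a · b' + c')
  <-rest : ∀ {a b c c'} → c <ₒ c' → (ω^ a · b + c) <ₒ (ω^ a · b + c')

-- γ <ω^ α  :  γ < ω^α  (for normal forms)
data _<ω^_ : Cnf → Cnf → Set where
  tail-zero : ∀ {α} → 𝟎 <ω^ α
  tail-lt   : ∀ {a b c α} → a <ₒ α → (ω^ a · b + c) <ω^ α

data WF : Cnf → Set where
  wf-zero : WF 𝟎
  wf-term : ∀ {α b γ} → WF α → 1 ≤ b → WF γ → γ <ω^ α → WF (ω^ α · b + γ)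

fin : ℕ → Cnf
fin zero    = 𝟎
fin (suc m) = ω^ 𝟎 · suc m + 𝟎

mulω : Cnf → ℕ → Cnf
mulω β zero    = 𝟎
mulω β (suc m) = ω^ β · suc m + 𝟎

isSucc : Cnf → Bool
isSucc 𝟎                           = false
isSucc (ω^ 𝟎 · b + γ)              = true
isSucc (ω^ (ω^ _ · _ + _) · b + γ) = isSucc γ

IsLimit : Cnf → Set
IsLimit ξ = (ξ ≢ 𝟎) × (isSucc ξ ≡ false)

-- ξ = α + m with α a limit (or 0) and m < ω:  split ξ = (α , m)
split : Cnf → Cnf × ℕ
split 𝟎                           = 𝟎 , 0
split (ω^ 𝟎 · b + γ)              = 𝟎 , b
split (ω^ (ω^ a · c + d) · b + γ) =
  (ω^ (ω^ a · c + d) · b + proj₁ (split γ)) , proj₂ (split γ)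

limPart : Cnf → Cnf
limPart ξ = proj₁ (split ξ)

finPart : Cnf → ℕ
finPart ξ = proj₂ (split ξ)

-- ξ - 1 for a successor ξ (identity-like junk otherwise)
pred : Cnf → Cnf
pred 𝟎                                 = 𝟎
pred (ω^ 𝟎 · zero + γ)                 = 𝟎
pred (ω^ 𝟎 · suc b + γ)                = fin b
pred (ω^ (ω^ a · c + d) · b + γ)       = ω^ (ω^ a · c + d) · b + pred γ

mc : Cnf → ℕ
mc 𝟎              = 0
mc (ω^ α · b + γ) = mc α ⊔ mc γ ⊔ b

mutual
  fsω : Cnf → ℕ → Cnf
  fsω 𝟎 n = 𝟎
  fsω α@(ω^ _ · _ + _) n =
    if isSucc α
    then mulω (pred α) n
    else ω^ (α [ n ]) · 1 + 𝟎

  _[_] : Cnf → ℕ → Cnf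
  𝟎 [ n ]                                = 𝟎
  (ω^ α · b + (ω^ a · c + d)) [ n ]     = ω^ α · b + ((ω^ a · c + d) [ n ])
  (ω^ α · zero + 𝟎) [ n ]               = 𝟎
  (ω^ α · suc zero + 𝟎) [ n ]           = fsω α n
  (ω^ α · suc (suc b) + 𝟎) [ n ]        = ω^ α · suc b + fsω α n

-- The function 𝔸ₖ, given by its graph:
--   𝔸 k ξ n   means  𝔸ₖ(ξ) = n
--   Iter k ξ i n  means  𝔸ₖ⁽ⁱ⁾(ξ) = n   (for ξ ≥ ω)

mutual
  data 𝔸 (k : ℕ) : Cnf → ℕ → Set where
    𝔸-fin : ∀ m → 𝔸 k (fin m) (suc m)
    𝔸-inf : ∀ {a c d b γ n} →
            Iter k (ω^ (ω^ a · c + d) · b + γ) k n →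
            𝔸 k (ω^ (ω^ a · c + d) · b + γ) n

  data Iter (k : ℕ) : Cnf → ℕ → ℕ → Set where
    it-succ : ∀ {ξ m n} → finPart ξ ≡ suc m → 𝔸 k (pred ξ) n → Iter k ξ 0 n
    it-lim  : ∀ {ξ} → finPart ξ ≡ 0 → Iter k ξ 0 (mc ξ)
    it-step : ∀ {ξ i p n} → Iter k ξ i p → 𝔸 k ((limPart ξ) [ p ]) n →
              Iter k ξ (suc i) n

-- Induction on ζ below λ. If ζ is a successor then 𝔸(ζ − 1) < 𝔸(ζ) and
-- λ[q] ≤ ζ − 1. If ζ is a limit then, as k ≥ 2, the iterates give
-- 𝔸(ζ[mc ζ]) = 𝔸⁽¹⁾(ζ) < 𝔸⁽ᵏ⁾(ζ) = 𝔸(ζ), and λ[q] ≤ ζ[mc ζ] by the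
-- Bachmann property of fundamental sequences (λ[q] < ζ < λ implies
-- λ[q] ≤ ζ[m] for every m ≥ 1). In both cases the smaller ordinal is either
-- λ[q] itself or again strictly between λ[q] and λ.
module Submission where

open import Data.Bool using (false; true)
open import Data.Empty using (⊥; ⊥-elim)
open import Data.Nat using (ℕ; zero; suc; _≤_; _<_; _⊔_; z≤n; s≤s)
open import Data.Nat.Induction using (<-wellFounded)
open import Data.Nat.Properties
open import Data.Product using (_×_; _,_; ∃; proj₁; proj₂)
open import Data.Sum using (_⊎_; inj₁; inj₂)
open import Induction.WellFounded using (Acc; acc; WellFounded)
open import Relation.Binary.PropositionalEquality hiding ([_])

open import Defs

<ₒ-trans : ∀ {x y z} → x <ₒ y → y <ₒ z → x <ₒ z
<ₒ-trans <-zero     (<-exp _)  = <-zero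
<ₒ-trans <-zero     (<-coef _) = <-zero
<ₒ-trans <-zero     (<-rest _) = <-zero
<ₒ-trans (<-exp p)  (<-exp q)  = <-exp (<ₒ-trans p q)
<ₒ-trans (<-exp p)  (<-coef _) = <-exp p
<ₒ-trans (<-exp p)  (<-rest _) = <-exp p
<ₒ-trans (<-coef _) (<-exp q)  = <-exp q
<ₒ-trans (<-coef p) (<-coef q) = <-coef (<-trans p q)
<ₒ-trans (<-coef p) (<-rest _) = <-coef p
<ₒ-trans (<-rest _) (<-exp q)  = <-exp q
<ₒ-trans (<-rest _) (<-coef q) = <-coef q
<ₒ-trans (<-rest p) (<-rest q) = <-rest (<ₒ-trans p q)

<ₒ-irrefl : ∀ {x} → x <ₒ x → ⊥
<ₒ-irrefl (<-exp p)  = <ₒ-irrefl p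
<ₒ-irrefl (<-coef p) = <-irrefl refl p
<ₒ-irrefl (<-rest p) = <ₒ-irrefl p

<ₒ-asym : ∀ {x y} → x <ₒ y → y <ₒ x → ⊥
<ₒ-asym p q = <ₒ-irrefl (<ₒ-trans p q)

_≤ₒ_ : Cnf → Cnf → Set
x ≤ₒ y = x ≡ y ⊎ x <ₒ y

≤ₒ-<ₒ-trans : ∀ {x y z} → x ≤ₒ y → y <ₒ z → x <ₒ z
≤ₒ-<ₒ-trans (inj₁ refl) q = q
≤ₒ-<ₒ-trans (inj₂ p)    q = <ₒ-trans p q

<ₒ-≤ₒ-trans : ∀ {x y z} → x <ₒ y → y ≤ₒ z → x <ₒ z
<ₒ-≤ₒ-trans p (inj₁ refl) = p
<ₒ-≤ₒ-trans p (inj₂ q)    = <ₒ-trans p q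

𝟎≤ₒ : ∀ x → 𝟎 ≤ₒ x
𝟎≤ₒ 𝟎              = inj₁ refl
𝟎≤ₒ (ω^ _ · _ + _) = inj₂ <-zero

≤ₒ-rest : ∀ {a b c c'} → c ≤ₒ c' → (ω^ a · b + c) ≤ₒ (ω^ a · b + c')
≤ₒ-rest (inj₁ refl) = inj₁ refl
≤ₒ-rest (inj₂ p)    = inj₂ (<-rest p)

≤ₒ-exp : ∀ {a a' b} → a ≤ₒ a' → (ω^ a · b + 𝟎) ≤ₒ (ω^ a' · b + 𝟎)
≤ₒ-exp (inj₁ refl) = inj₁ refl
≤ₒ-exp (inj₂ p)    = inj₂ (<-exp p)

<ₒ-<ω^-trans : ∀ {x y α} → x <ₒ y → y <ω^ α → x <ω^ α
<ₒ-<ω^-trans <-zero     _           = tail-zero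
<ₒ-<ω^-trans (<-exp p)  (tail-lt q) = tail-lt (<ₒ-trans p q)
<ₒ-<ω^-trans (<-coef _) (tail-lt q) = tail-lt q
<ₒ-<ω^-trans (<-rest _) (tail-lt q) = tail-lt q

<ω^⇒<ₒ : ∀ {x α b c} → x <ω^ α → x <ₒ (ω^ α · b + c)
<ω^⇒<ₒ tail-zero   = <-zero
<ω^⇒<ₒ (tail-lt p) = <-exp p

<ₒω^⇒exp<ₒ : ∀ {X e b δ} → WF (ω^ e · b + δ) → (ω^ e · b + δ) <ₒ (ω^ X · 1 + 𝟎) → e <ₒ X
<ₒω^⇒exp<ₒ _                  (<-exp p)          = p
<ₒω^⇒exp<ₒ (wf-term _ () _ _) (<-coef (s≤s z≤n))
<ₒω^⇒exp<ₒ _                  (<-rest ())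

between-same-head : ∀ {X b c₁ e b' δ c₂} →
  (ω^ X · b + c₁) <ₒ (ω^ e · b' + δ) → (ω^ e · b' + δ) <ₒ (ω^ X · b + c₂) →
  e ≡ X × b' ≡ b × c₁ <ₒ δ × δ <ₒ c₂
between-same-head (<-exp p)  (<-exp q)  = ⊥-elim (<ₒ-asym p q)
between-same-head (<-exp p)  (<-coef _) = ⊥-elim (<ₒ-irrefl p)
between-same-head (<-exp p)  (<-rest _) = ⊥-elim (<ₒ-irrefl p)
between-same-head (<-coef _) (<-exp q)  = ⊥-elim (<ₒ-irrefl q)
between-same-head (<-coef p) (<-coef q) = ⊥-elim (<-asym p q)
between-same-head (<-coef p) (<-rest _) = ⊥-elim (<-irrefl refl p)
between-same-head (<-rest _) (<-exp q)  = ⊥-elim (<ₒ-irrefl q)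
between-same-head (<-rest _) (<-coef q) = ⊥-elim (<-irrefl refl q)
between-same-head (<-rest p) (<-rest q) = refl , refl , p , q

between-succ-coef : ∀ {X b F e b' δ} →
  (ω^ X · suc b + F) <ₒ (ω^ e · b' + δ) → (ω^ e · b' + δ) <ₒ (ω^ X · suc (suc b) + 𝟎) →
  e ≡ X × b' ≡ suc b × F <ₒ δ
between-succ-coef _          (<-rest ())
between-succ-coef (<-exp p)  (<-exp q)  = ⊥-elim (<ₒ-asym p q)
between-succ-coef (<-coef _) (<-exp q)  = ⊥-elim (<ₒ-irrefl q)
between-succ-coef (<-rest _) (<-exp q)  = ⊥-elim (<ₒ-irrefl q)
between-succ-coef (<-exp p)  (<-coef _) = ⊥-elim (<ₒ-irrefl p)
between-succ-coef (<-coef p) (<-coef q) = ⊥-elim (<-irrefl refl (<-≤-trans p (≤-pred q)))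
between-succ-coef (<-rest p) (<-coef _) = refl , refl , p

wf-fin : ∀ m → WF (fin m)
wf-fin zero    = wf-zero
wf-fin (suc m) = wf-term wf-zero (s≤s z≤n) wf-zero tail-zero

fin-injective : ∀ m n → fin m ≡ fin n → m ≡ n
fin-injective zero    zero     _    = refl
fin-injective (suc m) (suc .m) refl = refl

mc-fin : ∀ m → mc (fin m) ≡ m
mc-fin zero    = refl
mc-fin (suc m) = refl

mc-exp-≤ : ∀ α b γ → mc α ≤ mc (ω^ α · b + γ)
mc-exp-≤ α b γ = ≤-trans (m≤m⊔n (mc α) (mc γ)) (m≤m⊔n (mc α ⊔ mc γ) b)

mc-tail-≤ : ∀ α b γ → mc γ ≤ mc (ω^ α · b + γ)
mc-tail-≤ α b γ = ≤-trans (m≤n⊔m (mc α) (mc γ)) (m≤m⊔n (mc α ⊔ mc γ) b)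

mc-coef-≤ : ∀ α b γ → b ≤ mc (ω^ α · b + γ)
mc-coef-≤ α b γ = m≤n⊔m (mc α ⊔ mc γ) b

pred-<ₒ : ∀ {ξ} → WF ξ → isSucc ξ ≡ true → pred ξ <ₒ ξ
pred-<ₒ {ω^ 𝟎 · zero + _}              (wf-term _ () _ _) _
pred-<ₒ {ω^ 𝟎 · suc zero + _}          _                  _ = <-zero
pred-<ₒ {ω^ 𝟎 · suc (suc b) + _}       _                  _ = <-coef (n<1+n (suc b))
pred-<ₒ {ω^ (ω^ _ · _ + _) · _ + _}    (wf-term _ _ wγ _) e = <-rest (pred-<ₒ wγ e)

wf-pred : ∀ {ξ} → WF ξ → isSucc ξ ≡ true → WF (pred ξ)
wf-pred {ω^ 𝟎 · zero + _}           (wf-term _ () _ _)     _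
wf-pred {ω^ 𝟎 · suc b + _}          _                      _ = wf-fin b
wf-pred {ω^ (ω^ _ · _ + _) · _ + _} (wf-term wα b≥1 wγ γ<) e =
  wf-term wα b≥1 (wf-pred wγ e) (<ₒ-<ω^-trans (pred-<ₒ wγ e) γ<)

<ₒ⇒≤ₒpred : ∀ {ξ x} → WF ξ → isSucc ξ ≡ true → WF x → x <ₒ ξ → x ≤ₒ pred ξ
<ₒ⇒≤ₒpred {ω^ 𝟎 · suc b + .𝟎} (wf-term _ _ _ tail-zero) _ _ <-zero = 𝟎≤ₒ (fin b)
<ₒ⇒≤ₒpred {ω^ 𝟎 · suc b + .𝟎} (wf-term _ _ _ tail-zero) _ _ (<-exp ())
<ₒ⇒≤ₒpred {ω^ 𝟎 · suc b + .𝟎} (wf-term _ _ _ tail-zero) _ _ (<-rest ())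
<ₒ⇒≤ₒpred {ω^ 𝟎 · suc zero + .𝟎} (wf-term _ _ _ tail-zero) _
  (wf-term _ (s≤s _) _ _) (<-coef (s≤s ()))
<ₒ⇒≤ₒpred {ω^ 𝟎 · suc (suc b) + .𝟎} (wf-term _ _ _ tail-zero) _
  (wf-term _ (s≤s z≤n) _ tail-zero) (<-coef (s≤s c≤b)) with m≤n⇒m<n∨m≡n c≤b
... | inj₁ c<b  = inj₂ (<-coef c<b)
... | inj₂ refl = inj₁ refl
<ₒ⇒≤ₒpred {ω^ (ω^ _ · _ + _) · _ + _} _ _ _ <-zero     = inj₂ <-zero
<ₒ⇒≤ₒpred {ω^ (ω^ _ · _ + _) · _ + _} _ _ _ (<-exp p)  = inj₂ (<-exp p)
<ₒ⇒≤ₒpred {ω^ (ω^ _ · _ + _) · _ + _} _ _ _ (<-coef p) = inj₂ (<-coef p)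
<ₒ⇒≤ₒpred {ω^ (ω^ _ · _ + _) · _ + _} (wf-term _ _ wγ _) e (wf-term _ _ wδ _) (<-rest p) =
  ≤ₒ-rest (<ₒ⇒≤ₒpred wγ e wδ p)

mc-pred : ∀ {ξ} → WF ξ → isSucc ξ ≡ true → mc ξ ≤ suc (mc (pred ξ))
mc-pred {ω^ 𝟎 · suc b + .𝟎} (wf-term _ _ _ tail-zero) _ rewrite mc-fin b = ≤-refl
mc-pred {ω^ α@(ω^ _ · _ + _) · b + γ} (wf-term _ _ wγ _) e =
  ⊔-lub (⊔-lub (≤-trans (mc-exp-≤ α b (pred γ)) (n≤1+n _))
               (≤-trans (mc-pred wγ e) (s≤s (mc-tail-≤ α b (pred γ)))))
        (≤-trans (mc-coef-≤ α b (pred γ)) (n≤1+n _))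

isSucc⇒finPart-suc : ∀ {ξ} → WF ξ → isSucc ξ ≡ true → ∃ λ m → finPart ξ ≡ suc m
isSucc⇒finPart-suc {ω^ 𝟎 · zero + _}           (wf-term _ () _ _) _
isSucc⇒finPart-suc {ω^ 𝟎 · suc b + _}          _                  _ = b , refl
isSucc⇒finPart-suc {ω^ (ω^ _ · _ + _) · _ + _} (wf-term _ _ wγ _) e = isSucc⇒finPart-suc wγ e

finPart-limit : ∀ {ξ} → WF ξ → isSucc ξ ≡ false → finPart ξ ≡ 0
finPart-limit {𝟎}                            _                  _ = refl
finPart-limit {ω^ 𝟎 · _ + _}                 _                  ()
finPart-limit {ω^ (ω^ _ · _ + _) · _ + _}    (wf-term _ _ wγ _) e = finPart-limit wγ e

finPart-suc⇒isSucc : ∀ {ξ m} → WF ξ → finPart ξ ≡ suc m → isSucc ξ ≡ true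
finPart-suc⇒isSucc {ξ} w e with isSucc ξ in es
... | true  = refl
... | false with () ← trans (sym e) (finPart-limit w es)

limPart-limit : ∀ {ξ} → WF ξ → isSucc ξ ≡ false → limPart ξ ≡ ξ
limPart-limit {𝟎}                         _                  _ = refl
limPart-limit {ω^ 𝟎 · _ + _}              _                  ()
limPart-limit {ω^ α@(ω^ _ · _ + _) · b + _} (wf-term _ _ wγ _) e =
  cong (ω^ α · b +_) (limPart-limit wγ e)

limPart-<ω^ : ∀ {γ α} → γ <ω^ α → limPart γ <ω^ α
limPart-<ω^ {𝟎}                         _           = tail-zero
limPart-<ω^ {ω^ 𝟎 · _ + _}              _           = tail-zero
limPart-<ω^ {ω^ (ω^ _ · _ + _) · _ + _} (tail-lt p) = tail-lt p

wf-limPart : ∀ {ξ} → WF ξ → WF (limPart ξ)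
wf-limPart {𝟎}                         _                          = wf-zero
wf-limPart {ω^ 𝟎 · _ + _}              _                          = wf-zero
wf-limPart {ω^ (ω^ _ · _ + _) · _ + _} (wf-term wα b≥1 wγ γ<) =
  wf-term wα b≥1 (wf-limPart wγ) (limPart-<ω^ γ<)

limPart-≤ₒ : ∀ ξ → limPart ξ ≤ₒ ξ
limPart-≤ₒ 𝟎                         = inj₁ refl
limPart-≤ₒ (ω^ 𝟎 · _ + _)            = inj₂ <-zero
limPart-≤ₒ (ω^ (ω^ _ · _ + _) · _ + γ) = ≤ₒ-rest (limPart-≤ₒ γ)

isSucc-limPart : ∀ ξ → isSucc (limPart ξ) ≡ false
isSucc-limPart 𝟎                           = refl
isSucc-limPart (ω^ 𝟎 · _ + _)              = refl
isSucc-limPart (ω^ (ω^ _ · _ + _) · _ + γ) = isSucc-limPart γ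

limPart-isLimit : ∀ {a c d b} γ → IsLimit (limPart (ω^ (ω^ a · c + d) · b + γ))
limPart-isLimit γ = (λ ()) , isSucc-limPart γ

mutual
  fsω-descends : ∀ X n → WF X → X ≢ 𝟎 → WF (fsω X n) × fsω X n <ω^ X
  fsω-descends 𝟎 _ _ X≢𝟎 = ⊥-elim (X≢𝟎 refl)
  fsω-descends X@(ω^ _ · _ + _) n wX _ with isSucc X in eX
  fsω-descends X@(ω^ _ · _ + _) zero    wX _ | true = wf-zero , tail-zero
  fsω-descends X@(ω^ _ · _ + _) (suc n) wX _ | true =
    wf-term (wf-pred wX eX) (s≤s z≤n) wf-zero tail-zero , tail-lt (pred-<ₒ wX eX)
  fsω-descends (ω^ 𝟎 · _ + _) n wX _ | false with () ← eX
  fsω-descends X@(ω^ (ω^ _ · _ + _) · _ + _) n wX _ | false =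
    let wX[n] , X[n]<X = fs-descends X n wX ((λ ()) , eX)
    in wf-term wX[n] (s≤s z≤n) wf-zero tail-zero , tail-lt X[n]<X

  fs-descends : ∀ Λ n → WF Λ → IsLimit Λ → WF (Λ [ n ]) × (Λ [ n ]) <ₒ Λ
  fs-descends 𝟎 _ _ (Λ≢𝟎 , _) = ⊥-elim (Λ≢𝟎 refl)
  fs-descends (ω^ 𝟎 · _ + _) _ _ (_ , ())
  fs-descends (ω^ X@(ω^ _ · _ + _) · b + γ@(ω^ _ · _ + _)) n (wf-term wX b≥1 wγ γ<) (_ , e) =
    let wγ[n] , γ[n]<γ = fs-descends γ n wγ ((λ ()) , e)
    in wf-term wX b≥1 wγ[n] (<ₒ-<ω^-trans γ[n]<γ γ<) , <-rest γ[n]<γ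
  fs-descends (ω^ (ω^ _ · _ + _) · zero + 𝟎) _ (wf-term _ () _ _) _
  fs-descends (ω^ X@(ω^ _ · _ + _) · suc zero + 𝟎) n (wf-term wX _ _ _) _ =
    let wfsω , fsω< = fsω-descends X n wX (λ ()) in wfsω , <ω^⇒<ₒ fsω<
  fs-descends (ω^ X@(ω^ _ · _ + _) · suc (suc b) + 𝟎) n (wf-term wX _ _ _) _ =
    let wfsω , fsω< = fsω-descends X n wX (λ ()) in
    wf-term wX (s≤s z≤n) wfsω fsω< , <-coef (n<1+n (suc b))

wf-fs : ∀ {Λ} n → WF Λ → IsLimit Λ → WF (Λ [ n ])
wf-fs n wΛ L = proj₁ (fs-descends _ n wΛ L)

fs-<ₒ : ∀ {Λ} n → WF Λ → IsLimit Λ → (Λ [ n ]) <ₒ Λ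
fs-<ₒ n wΛ L = proj₂ (fs-descends _ n wΛ L)

wf-limPart-fs : ∀ {ξ} p → WF ξ → IsLimit (limPart ξ) → WF (limPart ξ [ p ])
wf-limPart-fs p wξ L = wf-fs p (wf-limPart wξ) L

limPart-fs-<ₒ : ∀ {ξ} p → WF ξ → IsLimit (limPart ξ) → (limPart ξ [ p ]) <ₒ ξ
limPart-fs-<ₒ {ξ} p wξ L = <ₒ-≤ₒ-trans (fs-<ₒ p (wf-limPart wξ) L) (limPart-≤ₒ ξ)

mutual
  mc-fsω-≥ : ∀ X n → WF X → X ≢ 𝟎 → n ≤ mc (fsω X n)
  mc-fsω-≥ 𝟎 _ _ X≢𝟎 = ⊥-elim (X≢𝟎 refl)
  mc-fsω-≥ X@(ω^ _ · _ + _) n wX _ with isSucc X in eX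
  mc-fsω-≥ X@(ω^ _ · _ + _) zero    wX _ | true = z≤n
  mc-fsω-≥ X@(ω^ _ · _ + _) (suc n) wX _ | true = mc-coef-≤ (pred X) (suc n) 𝟎
  mc-fsω-≥ (ω^ 𝟎 · _ + _) n wX _ | false with () ← eX
  mc-fsω-≥ X@(ω^ (ω^ _ · _ + _) · _ + _) n wX _ | false =
    ≤-trans (mc-fs-≥ X n wX ((λ ()) , eX)) (mc-exp-≤ (X [ n ]) 1 𝟎)

  mc-fs-≥ : ∀ Λ n → WF Λ → IsLimit Λ → n ≤ mc (Λ [ n ])
  mc-fs-≥ 𝟎 _ _ (Λ≢𝟎 , _) = ⊥-elim (Λ≢𝟎 refl)
  mc-fs-≥ (ω^ 𝟎 · _ + _) _ _ (_ , ())
  mc-fs-≥ (ω^ X@(ω^ _ · _ + _) · b + γ@(ω^ _ · _ + _)) n (wf-term _ _ wγ _) (_ , e) =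
    ≤-trans (mc-fs-≥ γ n wγ ((λ ()) , e)) (mc-tail-≤ X b (γ [ n ]))
  mc-fs-≥ (ω^ (ω^ _ · _ + _) · zero + 𝟎) _ (wf-term _ () _ _) _
  mc-fs-≥ (ω^ X@(ω^ _ · _ + _) · suc zero + 𝟎) n (wf-term wX _ _ _) _ =
    mc-fsω-≥ X n wX (λ ())
  mc-fs-≥ (ω^ X@(ω^ _ · _ + _) · suc (suc b) + 𝟎) n (wf-term wX _ _ _) _ =
    ≤-trans (mc-fsω-≥ X n wX (λ ())) (mc-tail-≤ X (suc b) (fsω X n))

mc-≥1 : ∀ {α b γ} → WF (ω^ α · b + γ) → 1 ≤ mc (ω^ α · b + γ)
mc-≥1 {α} {b} {γ} (wf-term _ b≥1 _ _) = ≤-trans b≥1 (mc-coef-≤ α b γ)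

_≺_ : Cnf → Cnf → Set
x ≺ y = WF x × x <ₒ y

acc-𝟎 : Acc _≺_ 𝟎
acc-𝟎 = acc λ { (_ , ()) }

-- Lexicographic: accessibility of ω^a·b + c follows from that of a (which
-- also bounds every admissible tail) and of b in ℕ.
mutual
  acc-term : ∀ {a b c} → Acc _≺_ a → Acc _<_ b → Acc _≺_ c → Acc _≺_ (ω^ a · b + c)
  acc-term aa ab ac = acc (acc-term-below aa ab ac)

  acc-term-below : ∀ {a b c y} → Acc _≺_ a → Acc _<_ b → Acc _≺_ c →
                   y ≺ (ω^ a · b + c) → Acc _≺_ y
  acc-term-below _ _ _ (_ , <-zero) = acc-𝟎
  acc-term-below (acc rsa) _ _ (wy@(wf-term we _ _ _) , <-exp e<a) =
    acc-wf-term (rsa (we , e<a)) wy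
  acc-term-below aa (acc rsb) _ (wf-term _ _ wc' c'< , <-coef b'<b) =
    acc-term aa (rsb b'<b) (acc-tail aa wc' c'<)
  acc-term-below aa ab (acc rsc) (wf-term _ _ wc' _ , <-rest c'<c) =
    acc-term aa ab (rsc (wc' , c'<c))

  acc-wf-term : ∀ {a b c} → Acc _≺_ a → WF (ω^ a · b + c) → Acc _≺_ (ω^ a · b + c)
  acc-wf-term {b = b} aa (wf-term _ _ wc c<) = acc-term aa (<-wellFounded b) (acc-tail aa wc c<)

  acc-tail : ∀ {a c} → Acc _≺_ a → WF c → c <ω^ a → Acc _≺_ c
  acc-tail _         wf-zero                   tail-zero     = acc-𝟎
  acc-tail (acc rsa) wc@(wf-term we _ _ _) (tail-lt e<a) = acc-wf-term (rsa (we , e<a)) wc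

acc-wf : ∀ {x} → WF x → Acc _≺_ x
acc-wf wf-zero                = acc-𝟎
acc-wf w@(wf-term wa _ _ _) = acc-wf-term (acc-wf wa) w

≺-wellFounded : WellFounded _≺_
≺-wellFounded _ = acc λ (wy , _) → acc-wf wy

mutual
  fs-bachmann : ∀ {Λ ζ} q m → WF Λ → IsLimit Λ → 1 ≤ m → WF ζ → isSucc ζ ≡ false →
                (Λ [ q ]) <ₒ ζ → ζ <ₒ Λ → (Λ [ q ]) ≤ₒ (ζ [ m ])
  fs-bachmann {𝟎} _ _ _ (Λ≢𝟎 , _) _ _ _ _ _ = ⊥-elim (Λ≢𝟎 refl)
  fs-bachmann {ω^ 𝟎 · _ + _} _ _ _ (_ , ()) _ _ _ _ _
  fs-bachmann {ω^ (ω^ _ · _ + _) · _ + (ω^ _ · _ + _)} {𝟎} _ _ _ _ _ _ _ () _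
  fs-bachmann {ω^ X@(ω^ _ · _ + _) · b + γ@(ω^ _ · _ + _)} {ω^ _ · _ + _} q m
              (wf-term _ _ wγ _) (_ , eΛ) m≥1 wζ eζ h₁ h₂
    with between-same-head h₁ h₂
  fs-bachmann {ω^ X@(ω^ _ · _ + _) · b + (ω^ _ · _ + _)} {ω^ .X · .b + 𝟎} _ _ _ _ _ _ _ _ _
    | refl , refl , () , _
  fs-bachmann {ω^ X@(ω^ _ · _ + _) · b + (ω^ _ · _ + _)} {ω^ .X · .b + (ω^ 𝟎 · _ + _)} _ _ _ _ _ _ () _ _
    | refl , refl , _
  fs-bachmann {ω^ X@(ω^ _ · _ + _) · b + γ@(ω^ _ · _ + _)} {ω^ .X · .b + (ω^ (ω^ _ · _ + _) · _ + _)} q m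
              (wf-term _ _ wγ _) (_ , eΛ) m≥1 (wf-term _ _ wδ _) eδ _ _
    | refl , refl , γ[q]<δ , δ<γ =
    ≤ₒ-rest (fs-bachmann q m wγ ((λ ()) , eΛ) m≥1 wδ eδ γ[q]<δ δ<γ)
  fs-bachmann {ω^ (ω^ _ · _ + _) · zero + 𝟎} _ _ (wf-term _ () _ _) _ _ _ _ _ _
  fs-bachmann {ω^ X@(ω^ _ · _ + _) · suc zero + 𝟎} q m (wf-term wX _ _ _) _ m≥1 wζ eζ h₁ h₂ =
    fsω-bachmann X q m wX (λ ()) m≥1 wζ eζ h₁ h₂
  fs-bachmann {ω^ (ω^ _ · _ + _) · suc (suc _) + 𝟎} {𝟎} _ _ _ _ _ _ _ () _
  fs-bachmann {ω^ X@(ω^ _ · _ + _) · suc (suc b) + 𝟎} {ω^ _ · _ + _} q m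
              (wf-term wX _ _ _) _ m≥1 wζ eζ h₁ h₂
    with between-succ-coef h₁ h₂
  fs-bachmann {ω^ X@(ω^ _ · _ + _) · suc (suc b) + 𝟎} {ω^ .X · .(suc b) + 𝟎} _ _ _ _ _ _ _ _ _
    | refl , refl , ()
  fs-bachmann {ω^ X@(ω^ _ · _ + _) · suc (suc b) + 𝟎} {ω^ .X · .(suc b) + (ω^ 𝟎 · _ + _)} _ _ _ _ _ _ () _ _
    | refl , refl , _
  fs-bachmann {ω^ X@(ω^ _ · _ + _) · suc (suc b) + 𝟎} {ω^ .X · .(suc b) + (ω^ (ω^ _ · _ + _) · _ + _)} q m
              (wf-term wX _ _ _) _ m≥1 (wf-term _ _ wδ δ<) eδ _ _
    | refl , refl , fsω<δ =
    ≤ₒ-rest (fsω-bachmann X q m wX (λ ()) m≥1 wδ eδ fsω<δ (<ω^⇒<ₒ δ<))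

  fsω-bachmann : ∀ X q m {ζ} → WF X → X ≢ 𝟎 → 1 ≤ m → WF ζ → isSucc ζ ≡ false →
                 fsω X q <ₒ ζ → ζ <ₒ (ω^ X · 1 + 𝟎) → fsω X q ≤ₒ (ζ [ m ])
  fsω-bachmann 𝟎 _ _ _ X≢𝟎 _ _ _ _ _ = ⊥-elim (X≢𝟎 refl)
  fsω-bachmann X@(ω^ _ · _ + _) q m wX _ m≥1 wζ eζ h₁ h₂ with isSucc X in eX
  fsω-bachmann X@(ω^ _ · _ + _) zero m wX _ _ _ _ _ _ | true = 𝟎≤ₒ _
  fsω-bachmann X@(ω^ _ · _ + _) (suc q) m {ω^ _ · _ + _} wX _ _ wζ@(wf-term we _ _ _) _ h₁ h₂ | true =
    monomial-≤ₒ-fs m (<ₒ⇒≤ₒpred wX eX we (<ₒω^⇒exp<ₒ wζ h₂)) h₁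
  fsω-bachmann (ω^ 𝟎 · _ + _) _ _ _ _ _ _ _ _ _ | false with () ← eX
  fsω-bachmann X@(ω^ (ω^ _ · _ + _) · _ + _) q m {ω^ _ · _ + δ} _ _ _ _ _ (<-coef c<b) _ | false =
    monomial-≤ₒ-fs {δ = δ} m (inj₁ refl) (<-coef c<b)
  fsω-bachmann X@(ω^ (ω^ _ · _ + _) · _ + _) q m {ω^ _ · _ + δ} _ _ _ _ _ (<-rest 𝟎<δ) _ | false =
    monomial-≤ₒ-fs {δ = δ} m (inj₁ refl) (<-rest 𝟎<δ)
  fsω-bachmann X@(ω^ (ω^ _ · _ + _) · _ + _) q m {ω^ _ · _ + _} wX _ m≥1 wζ eζ (<-exp X[q]<e) h₂ | false =
    fsω-bachmann-exp X q m wX ((λ ()) , eX) m≥1 wζ eζ X[q]<e (<ₒω^⇒exp<ₒ wζ h₂)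

  fsω-bachmann-exp : ∀ X q m {e b δ} → WF X → IsLimit X → 1 ≤ m →
                     WF (ω^ e · b + δ) → isSucc (ω^ e · b + δ) ≡ false →
                     (X [ q ]) <ₒ e → e <ₒ X → (ω^ (X [ q ]) · 1 + 𝟎) ≤ₒ ((ω^ e · b + δ) [ m ])
  fsω-bachmann-exp X q m {δ = ω^ _ · _ + _} _ _ _ _ _ X[q]<e _ = inj₂ (<-exp X[q]<e)
  fsω-bachmann-exp X q m {b = zero} {𝟎} _ _ _ (wf-term _ () _ _) _ _ _
  fsω-bachmann-exp X q m {b = suc (suc _)} {𝟎} _ _ _ _ _ X[q]<e _ = inj₂ (<-exp X[q]<e)
  fsω-bachmann-exp X q m {𝟎} {suc zero} {𝟎} _ _ _ _ _ () _
  fsω-bachmann-exp X q m {e@(ω^ _ · _ + _)} {suc zero} {𝟎} wX LX m≥1 (wf-term we _ _ _) _ X[q]<e e<X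
    with isSucc e in ee
  ... | false = ≤ₒ-exp (fs-bachmann q m wX LX m≥1 we ee X[q]<e e<X)
  ... | true with m | m≥1
  ...   | suc _ | _ = ω^-≤ₒ-monomial (<ₒ⇒≤ₒpred we ee (wf-fs q wX LX) X[q]<e)

  monomial-≤ₒ-fs : ∀ {P c e b δ} m → e ≤ₒ P → (ω^ P · suc c + 𝟎) <ₒ (ω^ e · b + δ) →
                   (ω^ P · suc c + 𝟎) ≤ₒ ((ω^ e · b + δ) [ m ])
  monomial-≤ₒ-fs m e≤P (<-exp P<e) = ⊥-elim (<ₒ-irrefl (≤ₒ-<ₒ-trans e≤P P<e))
  monomial-≤ₒ-fs {δ = ω^ _ · _ + _} m _ (<-coef c<b) = inj₂ (<-coef c<b)
  monomial-≤ₒ-fs {b = suc zero} {𝟎} m _ (<-coef (s≤s ()))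
  monomial-≤ₒ-fs {b = suc (suc _)} {𝟎} m _ (<-coef c<b) with m<1+n⇒m<n∨m≡n c<b
  ... | inj₁ c<b-1 = inj₂ (<-coef c<b-1)
  ... | inj₂ refl  = ≤ₒ-rest (𝟎≤ₒ _)
  monomial-≤ₒ-fs m _ (<-rest <-zero) = ≤ₒ-rest (𝟎≤ₒ _)

  ω^-≤ₒ-monomial : ∀ {A P c} → A ≤ₒ P → (ω^ A · 1 + 𝟎) ≤ₒ (ω^ P · suc c + 𝟎)
  ω^-≤ₒ-monomial {c = zero}  (inj₁ refl) = inj₁ refl
  ω^-≤ₒ-monomial {c = suc _} (inj₁ refl) = inj₂ (<-coef (s≤s (s≤s z≤n)))
  ω^-≤ₒ-monomial             (inj₂ A<P)  = inj₂ (<-exp A<P)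

module _ {k : ℕ} where

  𝔸-fin-inversion : ∀ {ξ n} m → 𝔸 k ξ n → ξ ≡ fin m → n ≡ suc m
  𝔸-fin-inversion m       (𝔸-fin m') ξ≡ = cong suc (fin-injective m' m ξ≡)
  𝔸-fin-inversion zero    (𝔸-inf _)  ()
  𝔸-fin-inversion (suc _) (𝔸-inf _)  ()

  𝔸-inf-inversion : ∀ {ξ n a c d b γ} → 𝔸 k ξ n → ξ ≡ (ω^ (ω^ a · c + d) · b + γ) →
                    Iter k (ω^ (ω^ a · c + d) · b + γ) k n
  𝔸-inf-inversion (𝔸-fin zero)    ()
  𝔸-inf-inversion (𝔸-fin (suc _)) ()
  𝔸-inf-inversion (𝔸-inf it)      refl = it

  mutual
    𝔸-functional : ∀ {ξ n n'} → 𝔸 k ξ n → 𝔸 k ξ n' → n ≡ n'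
    𝔸-functional (𝔸-fin m)  d = sym (𝔸-fin-inversion m d refl)
    𝔸-functional (𝔸-inf it) d = Iter-functional it (𝔸-inf-inversion d refl)

    Iter-functional : ∀ {ξ i n n'} → Iter k ξ i n → Iter k ξ i n' → n ≡ n'
    Iter-functional (it-succ _ d) (it-succ _ d') = 𝔸-functional d d'
    Iter-functional (it-succ e _) (it-lim e')    with () ← trans (sym e) e'
    Iter-functional (it-lim e)    (it-succ e' _) with () ← trans (sym e) e'
    Iter-functional (it-lim _)    (it-lim _)     = refl
    Iter-functional (it-step it d) (it-step it' d') with Iter-functional it it'
    ... | refl = 𝔸-functional d d'

  mutual
    𝔸-total-acc : ∀ {ξ} → Acc _≺_ ξ → WF ξ → ∃ (𝔸 k ξ)
    𝔸-total-acc {𝟎}                            _  _ = 1 , 𝔸-fin 0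
    𝔸-total-acc {ω^ 𝟎 · zero + _}              _  (wf-term _ () _ _)
    𝔸-total-acc {ω^ 𝟎 · suc b + .𝟎}            _  (wf-term _ _ _ tail-zero) = suc (suc b) , 𝔸-fin (suc b)
    𝔸-total-acc {ω^ (ω^ _ · _ + _) · _ + γ}    ac w =
      let n , it = Iter-total ac w (limPart-isLimit γ) k in n , 𝔸-inf it

    Iter-total : ∀ {ξ} → Acc _≺_ ξ → WF ξ → IsLimit (limPart ξ) → ∀ i → ∃ (Iter k ξ i)
    Iter-total {ξ} (acc rs) w _ zero with isSucc ξ in es
    ... | true  = let m , e = isSucc⇒finPart-suc w es
                      n , d = 𝔸-total-acc (rs (wf-pred w es , pred-<ₒ w es)) (wf-pred w es)
                  in n , it-succ e d
    ... | false = mc ξ , it-lim (finPart-limit w es)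
    Iter-total ac@(acc rs) w L (suc i) =
      let p , it = Iter-total ac w L i
          n , d  = 𝔸-total-acc (rs (wf-limPart-fs p w L , limPart-fs-<ₒ p w L))
                               (wf-limPart-fs p w L)
      in n , it-step it d

  𝔸-total : ∀ {ξ} → WF ξ → ∃ (𝔸 k ξ)
  𝔸-total w = 𝔸-total-acc (≺-wellFounded _) w

module _ {k : ℕ} where

  mutual
    mc-<-𝔸 : ∀ {ξ n} → WF ξ → 𝔸 (suc k) ξ n → mc ξ < n
    mc-<-𝔸 _ (𝔸-fin m) rewrite mc-fin m = ≤-refl
    mc-<-𝔸 {ω^ _ · _ + γ} w (𝔸-inf (it-step it d)) =
      ≤-<-trans (mc-≤-Iter w (limPart-isLimit γ) it) (fs-index-<-𝔸 w (limPart-isLimit γ) d)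

    mc-≤-Iter : ∀ {ξ i n} → WF ξ → IsLimit (limPart ξ) → Iter (suc k) ξ i n → mc ξ ≤ n
    mc-≤-Iter w _ (it-succ e d) =
      let es = finPart-suc⇒isSucc w e
      in ≤-trans (mc-pred w es) (mc-<-𝔸 (wf-pred w es) d)
    mc-≤-Iter w _ (it-lim _)     = ≤-refl
    mc-≤-Iter w L (it-step it d) = ≤-trans (mc-≤-Iter w L it) (<⇒≤ (fs-index-<-𝔸 w L d))

    fs-index-<-𝔸 : ∀ {ξ p n} → WF ξ → IsLimit (limPart ξ) → 𝔸 (suc k) (limPart ξ [ p ]) n → p < n
    fs-index-<-𝔸 {p = p} w L d =
      ≤-<-trans (mc-fs-≥ _ p (wf-limPart w) L) (mc-<-𝔸 (wf-limPart-fs p w L) d)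

  Iter-strictMono : ∀ {ξ i j p n} → WF ξ → IsLimit (limPart ξ) →
                    Iter (suc k) ξ i p → Iter (suc k) ξ j n → i < j → p < n
  Iter-strictMono {n = n} w L it (it-step it' d) i<1+j with m<1+n⇒m<n∨m≡n i<1+j
  ... | inj₁ i<j  = <-trans (Iter-strictMono w L it it' i<j) (fs-index-<-𝔸 w L d)
  ... | inj₂ refl = subst (_< n) (sym (Iter-functional it it')) (fs-index-<-𝔸 w L d)

  𝔸-pred-< : ∀ {ζ a n} → WF ζ → isSucc ζ ≡ true → 𝔸 (suc k) ζ a → 𝔸 (suc k) (pred ζ) n → n < a
  𝔸-pred-< {ω^ 𝟎 · zero + _} (wf-term _ () _ _) _ _ _
  𝔸-pred-< {ω^ 𝟎 · suc b + .𝟎} (wf-term _ _ _ tail-zero) _ dζ dpred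
    rewrite 𝔸-fin-inversion (suc b) dζ refl | 𝔸-fin-inversion b dpred refl = ≤-refl
  𝔸-pred-< {ω^ (ω^ _ · _ + _) · _ + γ} w es dζ dpred =
    let _ , e = isSucc⇒finPart-suc w es
    in Iter-strictMono w (limPart-isLimit γ) (it-succ e dpred) (𝔸-inf-inversion dζ refl) (s≤s z≤n)

-- 𝔸(ζ[mc ζ]) is the first iterate 𝔸⁽¹⁾(ζ), so k ≥ 2 puts it strictly below 𝔸(ζ).
𝔸-fs-mc-< : ∀ {k ζ a p} → WF ζ → IsLimit ζ →
            𝔸 (suc (suc k)) ζ a → 𝔸 (suc (suc k)) (ζ [ mc ζ ]) p → p < a
𝔸-fs-mc-< {ζ = 𝟎} _ (ζ≢𝟎 , _) _ _ = ⊥-elim (ζ≢𝟎 refl)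
𝔸-fs-mc-< {ζ = ω^ 𝟎 · _ + _} _ (_ , ()) _ _
𝔸-fs-mc-< {k} {ζ@(ω^ (ω^ _ · _ + _) · _ + γ)} {p = p} w (_ , es) dζ dfs =
  Iter-strictMono w (limPart-isLimit γ) first-iterate (𝔸-inf-inversion dζ refl) (s≤s (s≤s z≤n))
  where
    first-iterate : Iter (suc (suc k)) ζ 1 p
    first-iterate = it-step (it-lim (finPart-limit w es))
                            (subst (λ t → 𝔸 (suc (suc k)) (t [ mc ζ ]) p) (sym (limPart-limit w es)) dfs)

module _ {k : ℕ} {Λ : Cnf} (wΛ : WF Λ) (LΛ : IsLimit Λ) (q : ℕ) where

  Between : Cnf → Set
  Between ζ = (Λ [ q ]) <ₒ ζ × ζ <ₒ Λ

  descent : ∀ {ζ} → WF ζ → Between ζ →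
            ∃ λ ζ' → ζ' ≺ ζ × (Λ [ q ]) ≤ₒ ζ' ×
                     (∀ {a n} → 𝔸 (suc (suc k)) ζ a → 𝔸 (suc (suc k)) ζ' n → n < a)
  descent {𝟎} _ (() , _)
  descent {ζ@(ω^ _ · _ + _)} w (h₁ , h₂) with isSucc ζ in es
  ... | true  = pred ζ , (wf-pred w es , pred-<ₒ w es)
              , <ₒ⇒≤ₒpred w es (wf-fs q wΛ LΛ) h₁ , 𝔸-pred-< w es
  ... | false = ζ [ mc ζ ] , (wf-fs (mc ζ) w Lζ , fs-<ₒ (mc ζ) w Lζ)
              , fs-bachmann q (mc ζ) wΛ LΛ (mc-≥1 w) w es h₁ h₂ , 𝔸-fs-mc-< w Lζ
    where
      Lζ : IsLimit ζ
      Lζ = (λ ()) , es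

  fs-𝔸-<-acc : ∀ {ζ a b} → Acc _≺_ ζ → WF ζ → Between ζ →
               𝔸 (suc (suc k)) ζ a → 𝔸 (suc (suc k)) (Λ [ q ]) b → b < a
  fs-𝔸-<-acc (acc rs) w between@(_ , ζ<Λ) dζ dΛq with descent w between
  ... | _  , _ , inj₁ refl , step = step dζ dΛq
  ... | ζ' , ζ'≺ζ@(w' , ζ'<ζ) , inj₂ h₁' , step =
    let n , dζ' = 𝔸-total w'
    in <-trans (fs-𝔸-<-acc (rs ζ'≺ζ) w' (h₁' , <ₒ-trans ζ'<ζ ζ<Λ) dζ' dΛq) (step dζ dζ')

lemma4p5 : ∀ (k : ℕ) → 2 ≤ k →
    ∀ (λ' : Cnf) → WF λ' → IsLimit λ' →
    ∀ (q : ℕ) (ζ : Cnf) → WF ζ → (λ' [ q ]) <ₒ ζ → ζ <ₒ λ' →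
      (∃ λ a → 𝔸 k ζ a) × (∃ λ b → 𝔸 k (λ' [ q ]) b) ×
      (∀ a b → 𝔸 k ζ a → 𝔸 k (λ' [ q ]) b → b < a)
lemma4p5 (suc (suc k)) (s≤s (s≤s z≤n)) Λ wΛ LΛ q ζ wζ h₁ h₂ =
  𝔸-total wζ , 𝔸-total (wf-fs q wΛ LΛ) ,
  λ _ _ → fs-𝔸-<-acc wΛ LΛ q (≺-wellFounded ζ) wζ (h₁ , h₂)
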